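{- For every instance of $1|jrp,s=1,r_j|F_{\max}+c_\mathcal{Q}$ there is an optimal solution in which the jobs are scheduled in non-decreasing order of release dates, every replenishment occurs at the release date of some job, and the machine is idle only before replenishments (i.e., every maximal idle period of the machine ends at a replenishment time).
   Context: Problem $1|jrp,s=1,r_j|F_{\max}+c_\mathcal{Q}$: a set $\mathcal{J}$ of $n$ jobs must be processed non-preemptively on a single machine that processes at most one job at a time. Job $j$ has processing time $p_j>0$ and release date $r_j\ge 0$. There is a single resource $R$, required by every job, and nonnegative costs $K_0,K_1$. A solution is a pair $(S,\mathcal{Q})$, where $S$ assigns a start time $S_j$ to each job (completion time $C_j=S_j+p_j$) and $\mathcal{Q}$ is a finite set of replenishment times $t_1<\dots<t_q$ at which $R$ is replenished. Job $j$ is ready to be started at time $t$ if some replenishment time lies in $[r_j,t]$. The solution is feasible if no two jobs overlap and each job $j$ is ready to be started at $S_j$. The cost is $F_{\max}+q(K_0+K_1)$, where $F_{\max}=\max_j(C_j-r_j)$; an optimal solution is a feasible solution of minimum cost.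
   Formalization: Stated for instances whose processing times, release dates and costs $K_0,K_1$ are rational, with all start times and replenishment times, including those of competing solutions, taken in ℚ. -}

module Defs where

open import Data.Nat using (ℕ)
open import Data.Fin using (Fin)
open import Data.Integer using (+_)
open import Data.Rational using (ℚ; 0ℚ; _/_; _+_; _-_; _*_; _⊔_; _≤_; _<_)
open import Data.List using (List; length; foldr; map; allFin)
open import Data.List.Membership.Propositional using (_∈_)
open import Data.List.Relation.Unary.Linked using (Linked)
open import Data.Product using (Σ; ∃; _×_; _,_)
open import Data.Sum using (_⊎_)
open import Relation.Binary.PropositionalEquality using (_≡_; _≢_)
open import Relation.Nullary using (¬_)

ℕ→ℚ : ℕ → ℚ
ℕ→ℚ k = + k / 1

module _ {n : ℕ} (p r : Fin n → ℚ) where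

  C : (S : Fin n → ℚ) → Fin n → ℚ
  C S j = S j + p j

  -- F_max = max_j (C_j - r_j); for n = 0 this is 0 (empty max).
  -- (For feasible schedules every term is ≥ p_j > 0, so base 0 is harmless.)
  Fmax : (S : Fin n → ℚ) → ℚ
  Fmax S = foldr _⊔_ 0ℚ (map (λ j → C S j - r j) (allFin n))

  ValidQ : List ℚ → Set
  ValidQ Q = Linked _<_ Q

  Ready : List ℚ → Fin n → ℚ → Set
  Ready Q j t = ∃ λ τ → τ ∈ Q × r j ≤ τ × τ ≤ t

  Feasible : (S : Fin n → ℚ) → List ℚ → Set
  Feasible S Q =
    ValidQ Q
    × (∀ i j → i ≢ j → C S i ≤ S j ⊎ C S j ≤ S i)
    × (∀ j → Ready Q j (S j))

  Cost : (K₀ K₁ : ℚ) → (S : Fin n → ℚ) → List ℚ → ℚ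
  Cost K₀ K₁ S Q = Fmax S + ℕ→ℚ (length Q) * (K₀ + K₁)

  Optimal : (K₀ K₁ : ℚ) → (S : Fin n → ℚ) → List ℚ → Set
  Optimal K₀ K₁ S Q =
    Feasible S Q
    × (∀ (S' : Fin n → ℚ) (Q' : List ℚ) → Feasible S' Q' →
         Cost K₀ K₁ S Q ≤ Cost K₀ K₁ S' Q')

  ERDOrder : (S : Fin n → ℚ) → Set
  ERDOrder S = ∀ i j → S i < S j → r i ≤ r j

  ReplAtRelease : List ℚ → Set
  ReplAtRelease Q = ∀ t → t ∈ Q → ∃ λ j → t ≡ r j

  -- every maximal idle period ends at a replenishment time:
  -- a maximal idle period (of the time axis starting at 0) ends exactly at a
  -- start time S_j > 0 at which no job completes; such S_j must be in Q.
  IdleOnlyBeforeRepl : (S : Fin n → ℚ) → List ℚ → Set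
  IdleOnlyBeforeRepl S Q =
    ∀ j → 0ℚ < S j → (∀ i → C S i ≢ S j) → S j ∈ Q

-- For a fixed increasing list Q of replenishment times, processing the jobs in order of
-- release date, each as early as possible, minimises F_max. Indeed, a job j of this schedule
-- ends a run of jobs processed back to back since the first replenishment t at or after some
-- ρ, all released in [ρ, r_j]. In any schedule where each job is ready at a replenishment of
-- Q, these jobs all start at or after t, so one of them, l, finishes at or after t plus their
-- total processing time, which bounds C_j; and r_l ≤ r_j, so C_j - r_j ≤ C_l - r_l.
-- Moving each replenishment of a feasible solution back to the latest release date not after
-- it keeps every job ready without adding replenishments. So the best of the finitely many
-- covering sets of release dates, each with its release-order schedule, is optimal, and that
-- schedule has the required shape by construction.

module Submission where

open import Defs
open import Data.Nat using (ℕ)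
open import Data.Fin using (Fin)
open import Data.Rational using (ℚ; 0ℚ; _≤_; _<_)
open import Data.List using (List)
open import Data.Product using (Σ; ∃; _×_; _,_)
open import Data.Product using (proj₁; proj₂)

open import Data.Bool using (true; false)
open import Data.Empty using (⊥-elim)
open import Data.Maybe using (Maybe; just; nothing)
open import Data.Nat as ℕ using (suc; z≤n; s≤s)
import Data.Nat.Coprimality as Coprime
import Data.Nat.Properties as ℕP
import Data.Integer as ℤ
import Data.Integer.Properties as ℤ
open import Data.Fin.Properties using (all?) renaming (_≟_ to _≟ᶠ_)
open import Data.Rational using (_+_; _-_; _*_; _⊔_; *≤*; nonNegative; _≤?_; _<?_; _≟_)
open import Relation.Binary.Bundles using (DecTotalOrder)
open import Data.Rational.Properties
open import Data.List.Extrema (DecTotalOrder.totalOrder ≤-decTotalOrder)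
  using (argmin; argmin-all; f[argmin]≤f[xs])
open import Data.Sum using (_⊎_; inj₁; inj₂; [_,_]′)
open import Data.List
  using ([]; _∷_; _++_; length; map; filter; foldr; allFin; mapMaybe; deduplicate)
open import Data.List.Properties
  using (foldr-preservesᵇ; foldr-preservesᵒ; length-map; length-catMaybes)
import Data.List.Relation.Unary.All as All
open import Data.List.Relation.Unary.All using (All; []; _∷_)
import Data.List.Relation.Unary.All.Properties as AllP
open import Data.List.Relation.Unary.Any using (Any; here; there; tail; any?)
import Data.List.Relation.Unary.Any.Properties as Any
open import Data.List.Relation.Unary.AllPairs using (AllPairs; []; _∷_)
open import Data.List.Relation.Unary.Linked using (Linked; []; [-]; _∷_; linked?)
import Data.List.Relation.Unary.Linked.Properties as Linked
open import Data.List.Relation.Unary.Unique.Propositional using (Unique)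
import Data.List.Relation.Unary.Unique.Propositional.Properties as Unique
open import Data.List.Relation.Unary.Unique.DecPropositional.Properties using (deduplicate-!)
open import Data.List.Membership.Propositional using (_∈_; _∉_; lose)
open import Data.List.Membership.Propositional.Properties
  using ( ∈-∃++; ∈-allFin; ∈-map⁺; ∈-map⁻; ∈-++⁺ˡ; ∈-++⁺ʳ; ∈-filter⁺; ∈-filter⁻
        ; ∈-deduplicate⁺; ∈-deduplicate⁻)
open import Data.List.Membership.DecPropositional _≟_ using (_∈?_)
open import Data.List.Relation.Binary.Subset.Propositional using (_⊆_)
open import Data.List.Relation.Binary.Permutation.Propositional using (_↭_; ↭-sym; ↭⇒↭ₛ)
open import Data.List.Relation.Binary.Permutation.Propositional.Properties
  using (shift; ↭-length; ∈-resp-↭; ¬x∷xs↭[]; map⁺)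
import Data.List.Relation.Binary.Permutation.Setoid.Properties as Permutation
import Data.List.Sort as Sort
open import Function using (_∘_; _on_)
open import Relation.Binary.Construct.On as On using ()
open import Relation.Binary.PropositionalEquality
  using (_≡_; _≢_; refl; sym; trans; cong; cong₂; subst; subst₂; setoid)
open import Relation.Nullary using (yes; no; does; _×-dec_)
open import Relation.Unary using (Decidable)

ℕ→ℚ-mono-≤ : ∀ {a b} → a ℕ.≤ b → ℕ→ℚ a ≤ ℕ→ℚ b
ℕ→ℚ-mono-≤ {a} {b} a≤b
  rewrite normalize-coprime (Coprime.sym (Coprime.1-coprimeTo a))
        | normalize-coprime (Coprime.sym (Coprime.1-coprimeTo b)) =
  *≤* (subst₂ ℤ._≤_ (sym (ℤ.*-identityʳ (ℤ.+ a))) (sym (ℤ.*-identityʳ (ℤ.+ b))) (ℤ.+≤+ a≤b))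

≤∧≢⇒< : ∀ {a b : ℚ} → a ≤ b → a ≢ b → a < b
≤∧≢⇒< a≤b a≢b = ≰⇒> (a≢b ∘ ≤-antisym a≤b)

-mono-≤ : ∀ {a b c d : ℚ} → a ≤ b → d ≤ c → a - c ≤ b - d
-mono-≤ a≤b d≤c = +-mono-≤ a≤b (neg-antimono-≤ d≤c)

p<p+q : ∀ {a b : ℚ} → 0ℚ < b → a < a + b
p<p+q {a} 0<b = subst (_< a + _) (+-identityʳ a) (+-monoʳ-< a 0<b)

≤-linked∧unique⇒<-linked : ∀ {xs : List ℚ} → Linked _≤_ xs → Unique xs → Linked _<_ xs
≤-linked∧unique⇒<-linked [] _ = []
≤-linked∧unique⇒<-linked [-] _ = [-]
≤-linked∧unique⇒<-linked (x≤y ∷ sorted) ((x≢y ∷ _) ∷ unique) =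
  ≤∧≢⇒< x≤y x≢y ∷ ≤-linked∧unique⇒<-linked sorted unique

∈-tail : ∀ {A : Set} {x j : A} {xs} → x ≢ j → j ∈ x ∷ xs → j ∈ xs
∈-tail x≢j = tail (x≢j ∘ sym)

Unique-resp-↭ : ∀ {A : Set} {xs ys : List A} → xs ↭ ys → Unique xs → Unique ys
Unique-resp-↭ σ = Permutation.Unique-resp-↭ (setoid _) (↭⇒↭ₛ σ)

length-≤-⊆ : ∀ {A : Set} {xs ys : List A} → Unique xs → xs ⊆ ys → length xs ℕ.≤ length ys
length-≤-⊆ [] _ = z≤n
length-≤-⊆ {xs = x ∷ xs} (x∉xs ∷ unique) xs⊆ys
  with as , bs , refl ← ∈-∃++ (xs⊆ys (here refl)) =
  subst (suc (length xs) ℕ.≤_) (sym (↭-length (shift x as bs)))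
    (s≤s (length-≤-⊆ unique λ z∈xs →
      tail (All.lookup x∉xs z∈xs ∘ sym) (∈-resp-↭ (shift x as bs) (xs⊆ys (there z∈xs)))))

sublists : ∀ {A : Set} → List A → List (List A)
sublists [] = [] ∷ []
sublists (x ∷ xs) = map (x ∷_) (sublists xs) ++ sublists xs

filter∈sublists : ∀ {A : Set} {P : A → Set} (P? : Decidable P) xs → filter P? xs ∈ sublists xs
filter∈sublists P? [] = here refl
filter∈sublists P? (x ∷ xs) with does (P? x)
... | true = ∈-++⁺ˡ (∈-map⁺ (x ∷_) (filter∈sublists P? xs))
... | false = ∈-++⁺ʳ (map (x ∷_) (sublists xs)) (filter∈sublists P? xs)

∈-mapMaybe⁺ : ∀ {A B : Set} (f : A → Maybe B) {x y xs} →
              x ∈ xs → f x ≡ just y → y ∈ mapMaybe f xs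
∈-mapMaybe⁺ f {xs = x ∷ _} (here refl) fx≡y rewrite fx≡y = here refl
∈-mapMaybe⁺ f {xs = x ∷ _} (there x∈xs) fx≡y with f x
... | nothing = ∈-mapMaybe⁺ f x∈xs fx≡y
... | just _ = there (∈-mapMaybe⁺ f x∈xs fx≡y)

maxUpTo : ℚ → List ℚ → Maybe ℚ
maxUpTo τ [] = nothing
maxUpTo τ (v ∷ vs) with v ≤? τ | maxUpTo τ vs
... | yes _ | nothing = just v
... | yes _ | just w = just (v ⊔ w)
... | no _ | w? = w?

maxUpTo-sound : ∀ τ vs {w} → maxUpTo τ vs ≡ just w → w ∈ vs × w ≤ τ
maxUpTo-sound τ (v ∷ vs) eq with v ≤? τ | maxUpTo τ vs | maxUpTo-sound τ vs
... | yes v≤τ | nothing | _ with refl ← eq = here refl , v≤τ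
... | yes v≤τ | just u | ih with refl ← eq | u∈vs , u≤τ ← ih refl =
  [ (λ v⊔u≡v → subst (_∈ v ∷ vs) (sym v⊔u≡v) (here refl))
  , (λ v⊔u≡u → subst (_∈ v ∷ vs) (sym v⊔u≡u) (there u∈vs))
  ]′ (⊔-sel v u) , ⊔-lub v≤τ u≤τ
... | no _ | just u | ih with u∈vs , u≤τ ← ih eq = there u∈vs , u≤τ

maxUpTo-complete : ∀ τ vs {v} → v ∈ vs → v ≤ τ → ∃ λ w → maxUpTo τ vs ≡ just w × v ≤ w
maxUpTo-complete τ (u ∷ vs) {v} v∈ v≤τ with u ≤? τ | maxUpTo τ vs | maxUpTo-complete τ vs {v}
maxUpTo-complete τ (u ∷ vs) (here refl) v≤τ | yes _ | nothing | _ = _ , refl , ≤-refl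
maxUpTo-complete τ (u ∷ vs) (there v∈vs) v≤τ | yes _ | nothing | ih with ih v∈vs v≤τ
... | _ , () , _
maxUpTo-complete τ (u ∷ vs) (here refl) v≤τ | yes _ | just w | _ = _ , refl , p≤p⊔q u w
maxUpTo-complete τ (u ∷ vs) (there v∈vs) v≤τ | yes _ | just w | ih
  with _ , refl , v≤w ← ih v∈vs v≤τ =
  _ , refl , ≤-trans v≤w (p≤q⊔p u w)
maxUpTo-complete τ (u ∷ vs) (here refl) v≤τ | no u≰τ | _ | _ = ⊥-elim (u≰τ v≤τ)
maxUpTo-complete τ (u ∷ vs) (there v∈vs) v≤τ | no _ | _ | ih = ih v∈vs v≤τ

-- Junk value ρ when no element of ts is ≥ ρ.
nextRepl : List ℚ → ℚ → ℚ
nextRepl [] ρ = ρ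
nextRepl (t ∷ ts) ρ with ρ ≤? t
... | yes _ = t
... | no _ = nextRepl ts ρ

nextRepl-≥ : ∀ ts ρ → ρ ≤ nextRepl ts ρ
nextRepl-≥ [] ρ = ≤-refl
nextRepl-≥ (t ∷ ts) ρ with ρ ≤? t
... | yes ρ≤t = ρ≤t
... | no _ = nextRepl-≥ ts ρ

nextRepl-∈ : ∀ ts ρ → Any (ρ ≤_) ts → nextRepl ts ρ ∈ ts
nextRepl-∈ (t ∷ ts) ρ ρ≤ts with ρ ≤? t
... | yes _ = here refl
... | no ρ≰t = there (nextRepl-∈ ts ρ (tail ρ≰t ρ≤ts))

nextRepl-≤ : ∀ {ts} ρ → AllPairs _<_ ts → ∀ {w} → w ∈ ts → ρ ≤ w → nextRepl ts ρ ≤ w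
nextRepl-≤ {t ∷ ts} ρ (t<ts ∷ sorted) w∈ ρ≤w with ρ ≤? t | w∈
... | yes _ | here refl = ≤-refl
... | yes _ | there w∈ts = <⇒≤ (All.lookup t<ts w∈ts)
... | no ρ≰t | here refl = ⊥-elim (ρ≰t ρ≤w)
... | no _ | there w∈ts = nextRepl-≤ ρ sorted w∈ts ρ≤w

module Sortℚ = Sort ≤-decTotalOrder

module Instance {n : ℕ} (p r : Fin n → ℚ) (p>0 : ∀ j → 0ℚ < p j) (r≥0 : ∀ j → 0ℚ ≤ r j) where

  NonOverlapping : (Fin n → ℚ) → Set
  NonOverlapping S = ∀ i j → i ≢ j → C p r S i ≤ S j ⊎ C p r S j ≤ S i

  totalTime : List (Fin n) → ℚ
  totalTime js = foldr _+_ 0ℚ (map p js)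

  totalTime-↭ : ∀ {js ks} → js ↭ ks → totalTime js ≡ totalTime ks
  totalTime-↭ σ =
    Permutation.foldr-commMonoid (setoid ℚ) +-0-isCommutativeMonoid (↭⇒↭ₛ (map⁺ p σ))

  module _ (S : Fin n → ℚ) (nonOverlapping : NonOverlapping S) where

    private
      module SortByStart = Sort (On.decTotalOrder ≤-decTotalOrder S)

    finish-≤-later-start : ∀ {x y} → x ≢ y → S x ≤ S y → C p r S x ≤ S y
    finish-≤-later-start {x} {y} x≢y Sx≤Sy with nonOverlapping x y x≢y
    ... | inj₁ Cx≤Sy = Cx≤Sy
    ... | inj₂ Cy≤Sx = ⊥-elim (<-irrefl refl (begin-strict
      S y         <⟨ p<p+q (p>0 y) ⟩
      C p r S y   ≤⟨ Cy≤Sx ⟩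
      S x         ≤⟨ Sx≤Sy ⟩
      S y         ∎))
      where open ≤-Reasoning

    ∃-finish-≥-total-sorted : ∀ {t x xs} → Linked (_≤_ on S) (x ∷ xs) → Unique (x ∷ xs) →
                              t ≤ S x → ∃ λ l → l ∈ x ∷ xs × t + totalTime (x ∷ xs) ≤ C p r S l
    ∃-finish-≥-total-sorted {t} {x} {[]} _ _ t≤Sx =
      x , here refl , subst (λ q → t + q ≤ C p r S x) (sym (+-identityʳ (p x))) (+-monoˡ-≤ (p x) t≤Sx)
    ∃-finish-≥-total-sorted {t} {x} {y ∷ ys} (Sx≤Sy ∷ sorted) ((x≢y ∷ _) ∷ unique) t≤Sx
      with l , l∈ , bound ← ∃-finish-≥-total-sorted sorted unique (finish-≤-later-start x≢y Sx≤Sy) =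
      l , there l∈ , (begin
        t + (p x + totalTime (y ∷ ys)) ≡⟨ +-assoc t (p x) _ ⟨
        (t + p x) + totalTime (y ∷ ys) ≤⟨ +-monoˡ-≤ _ (+-monoˡ-≤ (p x) t≤Sx) ⟩
        C p r S x + totalTime (y ∷ ys) ≤⟨ bound ⟩
        C p r S l                      ∎)
      where open ≤-Reasoning

    ∃-finish-≥-total : ∀ {t x xs} → Unique (x ∷ xs) → All (λ l → t ≤ S l) (x ∷ xs) →
                       ∃ λ l → l ∈ x ∷ xs × t + totalTime (x ∷ xs) ≤ C p r S l
    ∃-finish-≥-total {t} {x} {xs} unique t≤S
      with SortByStart.sort (x ∷ xs) | SortByStart.sort-↭ (x ∷ xs)
         | SortByStart.sort-↗ (x ∷ xs)
    ... | [] | σ | _ = ⊥-elim (¬x∷xs↭[] (↭-sym σ))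
    ... | y ∷ ys | σ | sorted
      with l , l∈ , bound ← ∃-finish-≥-total-sorted sorted
             (Unique-resp-↭ (↭-sym σ) unique)
             (All.lookup t≤S (∈-resp-↭ σ (here refl))) =
      l , ∈-resp-↭ σ l∈ , subst (λ T → t + T ≤ C p r S l) (totalTime-↭ σ) bound

  earliestStart : List ℚ → Fin n → ℚ → ℚ
  earliestStart Q x c = c ⊔ nextRepl Q (r x)

  freeAfter : List ℚ → Fin n → ℚ → ℚ
  freeAfter Q x c = earliestStart Q x c + p x

  -- Jobs outside the list get the junk start time 0.
  listStart : List ℚ → List (Fin n) → ℚ → Fin n → ℚ
  listStart Q [] c j = 0ℚ
  listStart Q (x ∷ xs) c j with x ≟ᶠ j
  ... | yes _ = earliestStart Q x c
  ... | no _ = listStart Q xs (freeAfter Q x c) j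

  c≤freeAfter : ∀ Q x c → c ≤ freeAfter Q x c
  c≤freeAfter Q x c = ≤-trans (p≤p⊔q c _) (<⇒≤ (p<p+q (p>0 x)))

  listStart-≥ : ∀ Q xs c {j} → j ∈ xs → c ≤ listStart Q xs c j
  listStart-≥ Q (x ∷ xs) c {j} j∈ with x ≟ᶠ j
  ... | yes _ = p≤p⊔q c _
  ... | no x≢j = ≤-trans (c≤freeAfter Q x c) (listStart-≥ Q xs _ (∈-tail x≢j j∈))

  listStart-ready : ∀ Q xs c {j} → j ∈ xs → nextRepl Q (r j) ≤ listStart Q xs c j
  listStart-ready Q (x ∷ xs) c {j} j∈ with x ≟ᶠ j
  ... | yes refl = p≤q⊔p c _
  ... | no x≢j = listStart-ready Q xs _ (∈-tail x≢j j∈)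

  listStart-nonOverlapping : ∀ Q xs c {i j} → i ∈ xs → j ∈ xs → i ≢ j →
    C p r (listStart Q xs c) i ≤ listStart Q xs c j ⊎ C p r (listStart Q xs c) j ≤ listStart Q xs c i
  listStart-nonOverlapping Q (x ∷ xs) c {i} {j} i∈ j∈ i≢j with x ≟ᶠ i | x ≟ᶠ j
  ... | yes refl | yes refl = ⊥-elim (i≢j refl)
  ... | yes refl | no x≢j = inj₁ (listStart-≥ Q xs _ (∈-tail x≢j j∈))
  ... | no x≢i | yes refl = inj₂ (listStart-≥ Q xs _ (∈-tail x≢i i∈))
  ... | no x≢i | no x≢j =
    listStart-nonOverlapping Q xs _ (∈-tail x≢i i∈) (∈-tail x≢j j∈) i≢j

  listStart-ERD : ∀ Q xs c → AllPairs (_≤_ on r) xs → ∀ {i j} → i ∈ xs → j ∈ xs →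
                  listStart Q xs c i < listStart Q xs c j → r i ≤ r j
  listStart-ERD Q (x ∷ xs) c (x≤xs ∷ sorted) {i} {j} i∈ j∈ Si<Sj with x ≟ᶠ i | x ≟ᶠ j
  ... | yes refl | yes refl = ≤-refl
  ... | yes refl | no x≢j = All.lookup x≤xs (∈-tail x≢j j∈)
  ... | no x≢i | yes refl = ⊥-elim (<-irrefl refl (<-trans (<-≤-trans (p<p+q (p>0 x))
          (listStart-≥ Q xs _ (∈-tail x≢i i∈))) Si<Sj))
  ... | no x≢i | no x≢j =
    listStart-ERD Q xs _ sorted (∈-tail x≢i i∈) (∈-tail x≢j j∈) Si<Sj

  listStart-head : ∀ Q x xs c → listStart Q (x ∷ xs) c x ≡ earliestStart Q x c
  listStart-head Q x xs c with x ≟ᶠ x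
  ... | yes _ = refl
  ... | no x≢x = ⊥-elim (x≢x refl)

  listStart-tail : ∀ Q {x j} xs c → x ≢ j →
                   listStart Q (x ∷ xs) c j ≡ listStart Q xs (freeAfter Q x c) j
  listStart-tail Q {x} {j} xs c x≢j with x ≟ᶠ j
  ... | yes x≡j = ⊥-elim (x≢j x≡j)
  ... | no _ = refl

  listStart-cases : ∀ Q xs c → Unique xs → ∀ {j} → j ∈ xs →
    listStart Q xs c j ≡ nextRepl Q (r j) ⊎ listStart Q xs c j ≡ c
    ⊎ ∃ λ i → i ∈ xs × C p r (listStart Q xs c) i ≡ listStart Q xs c j
  listStart-cases Q (x ∷ xs) c (x∉xs ∷ unique) {j} j∈ with x ≟ᶠ j
  ... | yes refl = [ inj₂ ∘ inj₁ , inj₁ ]′ (⊔-sel c _)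
  ... | no x≢j with listStart-cases Q xs (freeAfter Q x c) unique (∈-tail x≢j j∈)
  ...   | inj₁ eq = inj₁ eq
  ...   | inj₂ (inj₁ eq) =
    inj₂ (inj₂ (x , here refl , trans (cong (_+ p x) (listStart-head Q x xs c)) (sym eq)))
  ...   | inj₂ (inj₂ (i , i∈ , eq)) =
    inj₂ (inj₂ (i , there i∈ ,
                trans (cong (_+ p i) (listStart-tail Q xs c (All.lookup x∉xs i∈))) eq))

  -- The jobs js run back to back from the replenishment nextRepl Q ρ on, all released
  -- in [ρ, b], and the machine is free again by time c.
  record Run (Q : List ℚ) (js : List (Fin n)) (c b : ℚ) : Set where
    field
      ρ        : ℚ
      ρ≤b      : ρ ≤ b
      distinct : Unique js
      released : All (λ l → ρ ≤ r l × r l ≤ b) js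
      ends     : c ≤ nextRepl Q ρ + totalTime js

  run-step : ∀ {Q js c b x} → Run Q js c b → x ∉ js → b ≤ r x →
             ∃ λ js′ → js′ ⊆ js × Run Q (x ∷ js′) (freeAfter Q x c) (r x)
  run-step {Q} {js} {c} {b} {x} R x∉js b≤rx with c ≤? nextRepl Q (r x)
  ... | yes c≤τ = [] , (λ ()) , record
    { ρ        = r x
    ; ρ≤b      = ≤-refl
    ; distinct = [] ∷ []
    ; released = (≤-refl , ≤-refl) ∷ []
    ; ends     = ≤-reflexive (cong₂ _+_ (p≤q⇒p⊔q≡q c≤τ) (sym (+-identityʳ (p x))))
    }
  ... | no c≰τ = js , (λ l∈ → l∈) , record
    { ρ        = ρ
    ; ρ≤b      = ρ≤rx
    ; distinct = AllP.¬Any⇒All¬ js x∉js ∷ distinct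
    ; released = (ρ≤rx , ≤-refl) ∷
                 All.map (λ (ρ≤rl , rl≤b) → ρ≤rl , ≤-trans rl≤b b≤rx) released
    ; ends     = begin
        (c ⊔ nextRepl Q (r x)) + p x     ≡⟨ cong (_+ p x) (p≥q⇒p⊔q≡p (<⇒≤ (≰⇒> c≰τ))) ⟩
        c + p x                          ≤⟨ +-monoˡ-≤ (p x) ends ⟩
        (nextRepl Q ρ + totalTime js) + p x  ≡⟨ +-assoc (nextRepl Q ρ) _ (p x) ⟩
        nextRepl Q ρ + (totalTime js + p x)  ≡⟨ cong (nextRepl Q ρ +_) (+-comm _ (p x)) ⟩
        nextRepl Q ρ + totalTime (x ∷ js)    ∎
    }
    where
    open Run R
    open ≤-Reasoning
    ρ≤rx : ρ ≤ r x
    ρ≤rx = ≤-trans ρ≤b b≤rx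

  listStart-run : ∀ {Q js c b} xs → Run Q js c b → AllPairs (_≤_ on r) xs → Unique xs →
                  All (λ y → b ≤ r y × y ∉ js) xs → ∀ {j} → j ∈ xs →
                  ∃ λ js′ → Run Q (j ∷ js′) (C p r (listStart Q xs c) j) (r j)
  listStart-run (x ∷ xs) R (x≤xs ∷ sorted) (x∉xs ∷ unique) ((b≤rx , x∉js) ∷ ahead) {j} j∈
    with run-step R x∉js b≤rx | x ≟ᶠ j
  ... | js′ , _ , R′ | yes refl = js′ , R′
  ... | js′ , js′⊆js , R′ | no x≢j =
    listStart-run xs R′ sorted unique
      (All.zipWith (λ ((rx≤ry , x≢y) , (_ , y∉js)) →
         rx≤ry , λ { (here y≡x)    → x≢y (sym y≡x)
                   ; (there y∈js′) → y∉js (js′⊆js y∈js′) })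
       (All.zip (x≤xs , x∉xs) , ahead))
      (∈-tail x≢j j∈)

  module SortByRelease = Sort (On.decTotalOrder ≤-decTotalOrder r)

  erdOrder : List (Fin n)
  erdOrder = SortByRelease.sort (allFin n)

  erdOrder-complete : ∀ j → j ∈ erdOrder
  erdOrder-complete j = ∈-resp-↭ (↭-sym (SortByRelease.sort-↭ (allFin n))) (∈-allFin j)

  erdOrder-unique : Unique erdOrder
  erdOrder-unique =
    Unique-resp-↭ (↭-sym (SortByRelease.sort-↭ (allFin n))) (Unique.allFin⁺ n)

  erdOrder-sorted : AllPairs (_≤_ on r) erdOrder
  erdOrder-sorted = Linked.Linked⇒AllPairs ≤-trans (SortByRelease.sort-↗ (allFin n))

  erdSchedule : List ℚ → Fin n → ℚ
  erdSchedule Q = listStart Q erdOrder 0ℚ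

  private
    ≤-⊔ : ∀ {v} a b → v ≤ a ⊎ v ≤ b → v ≤ a ⊔ b
    ≤-⊔ a b = [ p≤q⇒p≤q⊔r b , p≤q⇒p≤r⊔q a ]′

  flows : (Fin n → ℚ) → List ℚ
  flows S = map (λ j → C p r S j - r j) (allFin n)

  Fmax-≥ : ∀ S j → C p r S j - r j ≤ Fmax p r S
  Fmax-≥ S j = foldr-preservesᵒ {P = C p r S j - r j ≤_} {f = _⊔_} ≤-⊔ 0ℚ (flows S)
                 (inj₂ (Any.map⁺ (lose (∈-allFin j) ≤-refl)))

  Fmax-nonneg : ∀ S → 0ℚ ≤ Fmax p r S
  Fmax-nonneg S = foldr-preservesᵒ {P = 0ℚ ≤_} {f = _⊔_} ≤-⊔ 0ℚ (flows S) (inj₁ ≤-refl)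

  Fmax-≤ : ∀ S {B} → 0ℚ ≤ B → (∀ j → C p r S j - r j ≤ B) → Fmax p r S ≤ B
  Fmax-≤ S {B} 0≤B bound =
    foldr-preservesᵇ {P = _≤ B} {f = _⊔_} ⊔-lub 0≤B (AllP.map⁺ (All.universal bound (allFin n)))

  Covers : List ℚ → Set
  Covers Q = ∀ j → Any (r j ≤_) Q

  erdSchedule-feasible : ∀ {Q} → ValidQ p r Q → Covers Q → Feasible p r (erdSchedule Q) Q
  erdSchedule-feasible {Q} valid covers =
    valid ,
    (λ i j → listStart-nonOverlapping Q erdOrder 0ℚ (erdOrder-complete i) (erdOrder-complete j)) ,
    λ j → nextRepl Q (r j) , nextRepl-∈ Q (r j) (covers j) , nextRepl-≥ Q (r j) ,
          listStart-ready Q erdOrder 0ℚ (erdOrder-complete j)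

  erdSchedule-ERD : ∀ Q → ERDOrder p r (erdSchedule Q)
  erdSchedule-ERD Q i j =
    listStart-ERD Q erdOrder 0ℚ erdOrder-sorted (erdOrder-complete i) (erdOrder-complete j)

  erdSchedule-idle : ∀ {Q} → Covers Q → IdleOnlyBeforeRepl p r (erdSchedule Q) Q
  erdSchedule-idle {Q} covers j 0<Sj noJobEnds
    with listStart-cases Q erdOrder 0ℚ erdOrder-unique (erdOrder-complete j)
  ... | inj₁ Sj≡τ = subst (_∈ Q) (sym Sj≡τ) (nextRepl-∈ Q (r j) (covers j))
  ... | inj₂ (inj₁ Sj≡0) = ⊥-elim (<-irrefl (sym Sj≡0) 0<Sj)
  ... | inj₂ (inj₂ (i , _ , Ci≡Sj)) = ⊥-elim (noJobEnds i Ci≡Sj)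

  erdSchedule-Fmax-≤ : ∀ {Q} → ValidQ p r Q → ∀ S → NonOverlapping S →
                       (∀ l → Ready p r Q l (S l)) → Fmax p r (erdSchedule Q) ≤ Fmax p r S
  erdSchedule-Fmax-≤ {Q} valid S nonOverlapping ready =
    Fmax-≤ (erdSchedule Q) (Fmax-nonneg S) flow-≤
    where
    starts-after : ∀ {ρ l} → ρ ≤ r l → nextRepl Q ρ ≤ S l
    starts-after {ρ} {l} ρ≤rl with τ , τ∈Q , rl≤τ , τ≤Sl ← ready l =
      ≤-trans (nextRepl-≤ ρ (Linked.Linked⇒AllPairs <-trans valid) τ∈Q (≤-trans ρ≤rl rl≤τ))
              τ≤Sl

    initial : Run Q [] 0ℚ 0ℚ
    initial = record
      { ρ        = 0ℚ
      ; ρ≤b      = ≤-refl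
      ; distinct = []
      ; released = []
      ; ends     = ≤-trans (nextRepl-≥ Q 0ℚ) (≤-reflexive (sym (+-identityʳ _)))
      }

    flow-≤ : ∀ j → C p r (erdSchedule Q) j - r j ≤ Fmax p r S
    flow-≤ j
      with listStart-run erdOrder initial erdOrder-sorted erdOrder-unique
             (All.universal (λ y → r≥0 y , λ ()) erdOrder) (erdOrder-complete j)
    ... | _ , R
      with ∃-finish-≥-total S nonOverlapping (Run.distinct R)
             (All.map (starts-after ∘ proj₁) (Run.released R))
    ... | l , l∈ , bound =
      ≤-trans (-mono-≤ (≤-trans (Run.ends R) bound) (proj₂ (All.lookup (Run.released R) l∈)))
              (Fmax-≥ S l)

  releaseDates : List ℚ
  releaseDates = Sortℚ.sort (deduplicate _≟_ (map r (allFin n)))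

  releaseDates-↭ : releaseDates ↭ deduplicate _≟_ (map r (allFin n))
  releaseDates-↭ = Sortℚ.sort-↭ _

  releaseDates-unique : Unique releaseDates
  releaseDates-unique = Unique-resp-↭ (↭-sym releaseDates-↭) (deduplicate-! _≟_ _)

  releaseDates-valid : ValidQ p r releaseDates
  releaseDates-valid = ≤-linked∧unique⇒<-linked (Sortℚ.sort-↗ _) releaseDates-unique

  ∈-releaseDates⁺ : ∀ j → r j ∈ releaseDates
  ∈-releaseDates⁺ j =
    ∈-resp-↭ (↭-sym releaseDates-↭) (∈-deduplicate⁺ _≟_ (∈-map⁺ r (∈-allFin j)))

  ∈-releaseDates⁻ : ∀ {t} → t ∈ releaseDates → ∃ λ j → t ≡ r j
  ∈-releaseDates⁻ t∈
    with j , _ , t≡rj ← ∈-map⁻ r (∈-deduplicate⁻ _≟_ _ (∈-resp-↭ releaseDates-↭ t∈)) = j , t≡rj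

  ⊆releaseDates⇒ReplAtRelease : ∀ {Q} → All (_∈ releaseDates) Q → ReplAtRelease p r Q
  ⊆releaseDates⇒ReplAtRelease Q⊆ t t∈Q = ∈-releaseDates⁻ (All.lookup Q⊆ t∈Q)

  latestRelease : ℚ → Maybe ℚ
  latestRelease τ = maxUpTo τ releaseDates

  round : List ℚ → List ℚ
  round Q = filter (_∈? mapMaybe latestRelease Q) releaseDates

  private
    inRound? : ∀ Q → Decidable (_∈ mapMaybe latestRelease Q)
    inRound? Q = _∈? mapMaybe latestRelease Q

  round-valid : ∀ Q → ValidQ p r (round Q)
  round-valid Q = Linked.filter⁺ (inRound? Q) <-trans releaseDates-valid

  round-⊆ : ∀ Q → round Q ⊆ releaseDates
  round-⊆ Q = proj₁ ∘ ∈-filter⁻ (inRound? Q) {xs = releaseDates}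

  round-length : ∀ Q → length (round Q) ℕ.≤ length Q
  round-length Q = begin
    length (round Q)                   ≤⟨ length-≤-⊆ (Unique.filter⁺ (inRound? Q) releaseDates-unique)
                                                     (proj₂ ∘ ∈-filter⁻ (inRound? Q) {xs = releaseDates}) ⟩
    length (mapMaybe latestRelease Q)  ≤⟨ length-catMaybes (map latestRelease Q) ⟩
    length (map latestRelease Q)       ≡⟨ length-map latestRelease Q ⟩
    length Q                           ∎
    where open ℕP.≤-Reasoning

  round-ready : ∀ {Q l t} → Ready p r Q l t → Ready p r (round Q) l t
  round-ready {Q} {l} (τ , τ∈Q , rl≤τ , τ≤t)
    with w , eq , rl≤w ← maxUpTo-complete τ releaseDates (∈-releaseDates⁺ l) rl≤τ
    with w∈ , w≤τ ← maxUpTo-sound τ releaseDates eq =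
    w , ∈-filter⁺ (inRound? Q) w∈ (∈-mapMaybe⁺ latestRelease τ∈Q eq) , rl≤w , ≤-trans w≤τ τ≤t

  Admissible : List ℚ → Set
  Admissible Q = ValidQ p r Q × Covers Q × All (_∈ releaseDates) Q

  admissible? : Decidable Admissible
  admissible? Q =
    linked? _<?_ Q ×-dec all? (λ j → any? (r j ≤?_) Q) ×-dec All.all? (_∈? releaseDates) Q

  releaseDates-admissible : Admissible releaseDates
  releaseDates-admissible =
    releaseDates-valid , (λ j → lose (∈-releaseDates⁺ j) ≤-refl) , All.tabulate (λ t∈ → t∈)

  round-admissible : ∀ {S Q} → Feasible p r S Q → Admissible (round Q)
  round-admissible {S} {Q} (_ , _ , ready) =
    round-valid Q , covers , All.tabulate (round-⊆ Q)
    where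
    covers : Covers (round Q)
    covers j with w , w∈ , rj≤w , _ ← round-ready (ready j) = lose w∈ rj≤w

  candidates : List (List ℚ)
  candidates = filter admissible? (sublists releaseDates)

  round∈candidates : ∀ {S Q} → Feasible p r S Q → round Q ∈ candidates
  round∈candidates feasible =
    ∈-filter⁺ admissible? (filter∈sublists _ releaseDates) (round-admissible feasible)

  module Costs (K₀ K₁ : ℚ) (K₀≥0 : 0ℚ ≤ K₀) (K₁≥0 : 0ℚ ≤ K₁) where

    Cost-mono-≤ : ∀ S S′ Q Q′ → Fmax p r S ≤ Fmax p r S′ → length Q ℕ.≤ length Q′ →
                  Cost p r K₀ K₁ S Q ≤ Cost p r K₀ K₁ S′ Q′
    Cost-mono-≤ _ _ _ _ F≤F′ len≤len′ =
      +-mono-≤ F≤F′ (*-monoʳ-≤-nonNeg (K₀ + K₁) {{nonNegative (+-mono-≤ K₀≥0 K₁≥0)}}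
                                      (ℕ→ℚ-mono-≤ len≤len′))

    cost : List ℚ → ℚ
    cost Q = Cost p r K₀ K₁ (erdSchedule Q) Q

    round-cost-≤ : ∀ S Q → Feasible p r S Q → cost (round Q) ≤ Cost p r K₀ K₁ S Q
    round-cost-≤ S Q (_ , nonOverlapping , ready) =
      Cost-mono-≤ (erdSchedule (round Q)) S (round Q) Q
        (erdSchedule-Fmax-≤ (round-valid Q) S nonOverlapping (round-ready ∘ ready))
        (round-length Q)

    bestRepl : List ℚ
    bestRepl = argmin cost releaseDates candidates

    bestRepl-admissible : Admissible bestRepl
    bestRepl-admissible =
      argmin-all cost releaseDates-admissible (AllP.all-filter admissible? (sublists releaseDates))

    bestRepl-optimal : ∀ S Q → Feasible p r S Q → cost bestRepl ≤ Cost p r K₀ K₁ S Q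
    bestRepl-optimal S Q feasible =
      ≤-trans (All.lookup (f[argmin]≤f[xs] {f = cost} releaseDates candidates)
                          (round∈candidates feasible))
              (round-cost-≤ S Q feasible)

lemma2 : (n : ℕ) (p r : Fin n → ℚ) (K₀ K₁ : ℚ)
    → (∀ j → 0ℚ < p j) → (∀ j → 0ℚ ≤ r j) → 0ℚ ≤ K₀ → 0ℚ ≤ K₁
    → Σ (Fin n → ℚ) λ S → Σ (List ℚ) λ Q →
    Optimal p r K₀ K₁ S Q
    × ERDOrder p r S
    × ReplAtRelease p r Q
    × IdleOnlyBeforeRepl p r S Q
lemma2 n p r K₀ K₁ p>0 r≥0 K₀≥0 K₁≥0 =
  let open Instance p r p>0 r≥0
      open Costs K₀ K₁ K₀≥0 K₁≥0
      valid , covers , atReleases = bestRepl-admissible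
  in erdSchedule bestRepl , bestRepl ,
     (erdSchedule-feasible valid covers , bestRepl-optimal) ,
     erdSchedule-ERD bestRepl ,
     ⊆releaseDates⇒ReplAtRelease atReleases ,
     erdSchedule-idle covers
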